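{- Let $\Gamma$ be a (directed or undirected) strongly regular graph with parameters $(n,k,t,\lambda,\mu)$, and let $\pi=\{C_1,\ldots,C_a\}$ be a homogeneous partition of $V(\Gamma)$ into $a$ cells of size $b$ (so $ab=n$). Suppose that the $\pi$-join $\Gamma^1_\pi$ of $\Gamma$ in power $1$ is a directed strongly regular graph with parameters $(\tilde n,\tilde k,\tilde t,\tilde\lambda,\tilde\mu)$. Then: (a) $\tilde n=(a+1)n$, $\tilde k=n+k$, $\tilde t=b+t$, $\tilde\lambda=b+\lambda$, and $\tilde\mu=b+\mu$; (b) for arbitrary $i,l\in\{1,\ldots,a\}$, the number $q_{i,l}$ of arcs of $\Gamma$ starting in $C_i$ and terminating in a vertex $v\in C_l$ does not depend on the choice of $v\in C_l$, and $$q_{i,l}=\begin{cases}\lambda+b-k & \text{if } i=l,\\ \mu & \text{if } i\neq l.\end{cases}$$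
   Context: All graphs are finite, without loops or multiple arcs; an undirected edge is regarded as a pair of opposite arcs. A directed strongly regular graph (DSRG) with parameters $(n,k,t,\lambda,\mu)$ is a digraph on $n$ vertices whose adjacency matrix $A$ (a $0/1$ matrix with zero diagonal) satisfies $AJ=JA=kJ$ and $A^2=tI+\lambda A+\mu(J-I-A)$. An undirected strongly regular graph with parameters $(n,k,\lambda,\mu)$ is regarded as a DSRG with parameters $(n,k,k,\lambda,\mu)$. A partition is homogeneous of degree $b$ if all cells have exactly $b$ vertices. The $\pi$-join of $\Gamma$ in power $j$ (for a homogeneous partition $\pi=\{C_1,\dots,C_a\}$ and positive integer $j$) is the digraph $\Gamma^j_\pi$ with vertex set $V(\Gamma)\times\{0,1,\ldots,ja\}$ and the following arcs: $(u,r)\to(v,r)$ whenever $u\to v$ is an arc of $\Gamma$; and for every vertex $(u,r)$, every $i\in\{1,\ldots,a\}$ and every $m\in\{1,\ldots,j\}$, arcs from $(u,r)$ to all vertices $(v,r')$ with $v\in C_i$ and $r'\equiv r+(i-1)j+m \pmod{ja+1}$. There are no other arcs. -}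

module Defs where

open import Data.Nat using (ℕ; zero; suc; _+_; _*_; _%_; _≡ᵇ_)
open import Data.Bool using (Bool; true; false; if_then_else_; _∧_; _∨_)
open import Data.Fin using (Fin; zero; suc; toℕ; remQuot)
open import Data.List using (upTo)
open import Data.Bool.ListAction using (any)
open import Data.Product using (_×_; _,_)
open import Relation.Binary.PropositionalEquality using (_≡_; _≢_)

-- A digraph on the vertex set Fin n, given by its 0/1 adjacency matrix
-- (true = arc u → v).
Digraph : ℕ → Set
Digraph n = Fin n → Fin n → Bool

count : ∀ {m} → (Fin m → Bool) → ℕ
count {zero}  f = 0
count {suc m} f = (if f zero then 1 else 0) + count (λ x → f (suc x))

-- A is the adjacency matrix of a DSRG with parameters (n,k,t,λ,μ):
-- zero diagonal, AJ = JA = kJ, and A² = tI + λA + μ(J - I - A) entrywise.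
record IsDSRG (n : ℕ) (A : Digraph n) (k t λ' μ : ℕ) : Set where
  field
    loopless : ∀ u → A u u ≡ false
    outDeg   : ∀ u → count (λ v → A u v) ≡ k
    inDeg    : ∀ v → count (λ u → A u v) ≡ k
    sqDiag   : ∀ u → count (λ w → A u w ∧ A w u) ≡ t
    sqArc    : ∀ u v → u ≢ v → A u v ≡ true →
               count (λ w → A u w ∧ A w v) ≡ λ'
    sqNonArc : ∀ u v → u ≢ v → A u v ≡ false →
               count (λ w → A u w ∧ A w v) ≡ μ

-- A partition of Fin n into a cells C_1,…,C_a (cell v = i means v ∈ C_{i+1}),
-- homogeneous of degree b: every cell has exactly b vertices.
IsHomogeneous : ∀ {n a} → (Fin n → Fin a) → ℕ → Set
IsHomogeneous {n} {a} cell b =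
  ∀ (i : Fin a) → count (λ v → toℕ (cell v) ≡ᵇ toℕ i) ≡ b

-- The vertex set V(Γ) × {0,…,ja} is encoded as
-- Fin (n * suc (j * a)) via remQuot : x ↦ (u , r).
-- (u,r) → (v,r') iff  (r = r' and u → v in Γ)  or
--   r' ≡ r + (i-1) j + m  (mod ja+1) for some m ∈ {1,…,j}, where v ∈ C_i
-- (here i - 1 = toℕ (cell v), and m = suc m0 with m0 ∈ {0,…,j-1}).
join : ∀ {n a} → Digraph n → (Fin n → Fin a) → (j : ℕ) →
       Digraph (n * suc (j * a))
join {n} {a} A cell j x y with remQuot (suc (j * a)) x | remQuot (suc (j * a)) y
... | (u , r) | (v , r') =
  ((toℕ r ≡ᵇ toℕ r') ∧ A u v) ∨
  any (λ m0 → ((toℕ r + toℕ (cell v) * j + suc m0) % suc (j * a)) ≡ᵇ toℕ r')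
      (upTo j)

arcsInto : ∀ {n a} → Digraph n → (Fin n → Fin a) → Fin a → Fin n → ℕ
arcsInto A cell i v = count (λ u → A u v ∧ (toℕ (cell u) ≡ᵇ toℕ i))

module Submission where

-- The π-join of Γ in power 1 has vertex set V(Γ) × {0,…,a}: "layers" 0,…,a.
-- Inside a layer it copies Γ, and from every layer r there is a jump arc to
-- each v at layer r + c(v) + 1 (mod a+1), where v ∈ C_{c(v)+1}.  All five
-- parameters of the join, and the numbers q_{i,l}, are read off by counting
-- arcs and two-step walks out of one bottom vertex x₀ = (u,0):
--   * the out-neighbours of (u,0) are the (w,0) with u → w, plus exactly one
--     vertex (w, c(w)+1) above every w  (out-of-bottom);
--   * hence a two-step walk (u,0) → (w,s) → (v,r') either stays in Γ's copy
--     or jumps up first; the second kind ends in a given layer T ≠ c(v)+1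
--     iff w lies in one particular cell, contributing exactly b walks
--     (jumps-hitting, a statement about addition modulo a+1).
-- Counting walks into (v,0) gives t̃, λ̃, μ̃; counting walks into (v, i+1),
-- which is an arc of the join iff v ∈ C_{i+1}, gives part (b).

open import Defs
open import Data.Nat using (ℕ; zero; suc; _+_; _*_; _<_; _≤_; _%_; _∸_; _≡ᵇ_; z≤n; s≤s; NonZero)
open import Data.Nat.Properties
open import Data.Nat.DivMod using (%-distribˡ-+; m%n%n≡m%n; [m+n]%n≡m%n; m<n⇒m%n≡m; m%n<n)
open import Data.Fin using (Fin; zero; suc; toℕ; fromℕ<; cast; combine; punchIn; _↑ˡ_; _↑ʳ_)
open import Data.Fin.Properties using (toℕ-injective; toℕ<n; toℕ-fromℕ<; toℕ-cast; remQuot-combine; combine-injectiveˡ; combine-injectiveʳ; punchInᵢ≢i) renaming (0≢1+n to zero≢suc)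
open import Data.Bool using (Bool; true; false; if_then_else_; _∧_; _∨_)
open import Data.Bool.Properties using (∧-identityʳ; ∨-identityʳ; ∧-zeroʳ; ∧-comm; T-≡; ⇔→≡)
open import Data.List using (upTo)
open import Data.Bool.ListAction using (any)
open import Data.Product using (Σ; ∃; _×_; _,_; proj₁; proj₂)
open import Relation.Nullary using (contradiction)
open import Function using (_∘_; mk⇔; Equivalence)
open import Algebra.Properties.CommutativeMonoid.Sum +-0-commutativeMonoid using (sum; sum-cong-≗; ∑-distrib-+; sum-remove; sum-replicate-zero)
open import Relation.Binary.PropositionalEquality

≡ᵇ-true : ∀ {m n} → m ≡ n → (m ≡ᵇ n) ≡ true
≡ᵇ-true {m} {n} m≡n = Equivalence.to T-≡ (≡⇒≡ᵇ m n m≡n)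

≡ᵇ-sound : ∀ {m n} → (m ≡ᵇ n) ≡ true → m ≡ n
≡ᵇ-sound {m} {n} h = ≡ᵇ⇒≡ m n (Equivalence.from T-≡ h)

≡ᵇ-false : ∀ {m n} → m ≢ n → (m ≡ᵇ n) ≡ false
≡ᵇ-false {m} {n} m≢n with m ≡ᵇ n in eq
... | true  = contradiction (≡ᵇ-sound eq) m≢n
... | false = refl

ind : Bool → ℕ
ind b = if b then 1 else 0

ind-∨ : ∀ b c → b ∧ c ≡ false → ind (b ∨ c) ≡ ind b + ind c
ind-∨ true  true  ()
ind-∨ true  false _ = refl
ind-∨ false c     _ = refl

count-as-sum : ∀ {m} (f : Fin m → Bool) → count f ≡ sum (ind ∘ f)
count-as-sum {zero}  f = refl
count-as-sum {suc m} f = cong (ind (f zero) +_) (count-as-sum (f ∘ suc))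

count-cong : ∀ {m} {f g : Fin m → Bool} → (∀ x → f x ≡ g x) → count f ≡ count g
count-cong {zero}  f≗g = refl
count-cong {suc m} f≗g = cong₂ _+_ (cong ind (f≗g zero)) (count-cong (f≗g ∘ suc))

count-all : ∀ {m} → count {m} (λ _ → true) ≡ m
count-all {zero}  = refl
count-all {suc m} = cong suc (count-all {m})

count-none : ∀ {m} → count {m} (λ _ → false) ≡ 0
count-none {zero}  = refl
count-none {suc m} = count-none {m}

count-∨ : ∀ {m} (f g : Fin m → Bool) → (∀ x → f x ∧ g x ≡ false) →
          count (λ x → f x ∨ g x) ≡ count f + count g
count-∨ f g disjoint = begin
  count (λ x → f x ∨ g x)             ≡⟨ count-as-sum (λ x → f x ∨ g x) ⟩
  sum (λ x → ind (f x ∨ g x))         ≡⟨ sum-cong-≗ (λ x → ind-∨ (f x) (g x) (disjoint x)) ⟩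
  sum (λ x → ind (f x) + ind (g x))   ≡⟨ ∑-distrib-+ (ind ∘ f) (ind ∘ g) ⟩
  sum (ind ∘ f) + sum (ind ∘ g)       ≡⟨ sym (cong₂ _+_ (count-as-sum f) (count-as-sum g)) ⟩
  count f + count g                   ∎
  where open ≡-Reasoning

count-remove : ∀ {m} (f : Fin (suc m) → Bool) (p : Fin (suc m)) →
               count f ≡ ind (f p) + count (f ∘ punchIn p)
count-remove f p = begin
  count f                           ≡⟨ count-as-sum f ⟩
  sum (ind ∘ f)                     ≡⟨ sum-remove {i = p} (ind ∘ f) ⟩
  ind (f p) + sum (ind ∘ f ∘ punchIn p) ≡⟨ cong (ind (f p) +_) (sym (count-as-sum (f ∘ punchIn p))) ⟩
  ind (f p) + count (f ∘ punchIn p) ∎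
  where open ≡-Reasoning

count-pos : ∀ {m} (f : Fin m → Bool) → 0 < count f → ∃ λ x → f x ≡ true
count-pos {suc m} f pos with f zero in eq
... | true  = zero , eq
... | false with count-pos (f ∘ suc) pos
...   | x , fx = suc x , fx

count-lt : ∀ {m} (f : Fin m → Bool) → count f < m → ∃ λ x → f x ≡ false
count-lt {suc m} f small with f zero in eq
... | false = zero , eq
... | true with count-lt (f ∘ suc) (≤-pred small)
...   | x , fx = suc x , fx

count-avoid : ∀ {m} (f : Fin (suc m) → Bool) (p : Fin (suc m)) → count f < m →
              ∃ λ x → x ≢ p × f x ≡ false
count-avoid {m} f p small =
  let (y , fy) = count-lt (f ∘ punchIn p) rest-small in punchIn p y , punchInᵢ≢i p y , fy
  where
  rest-small : count (f ∘ punchIn p) < m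
  rest-small = ≤-<-trans (m≤n+m _ (ind (f p))) (subst (_< m) (count-remove f p) small)

sum-point : ∀ {m} (t : Fin m → ℕ) (p : Fin m) → (∀ j → j ≢ p → t j ≡ 0) → sum t ≡ t p
sum-point {suc m} t p vanish = begin
  sum t                      ≡⟨ sum-remove {i = p} t ⟩
  t p + sum (t ∘ punchIn p)  ≡⟨ cong (t p +_) (trans (sum-cong-≗ (λ j → vanish _ (punchInᵢ≢i p j)))
                                                    (sum-replicate-zero m)) ⟩
  t p + 0                    ≡⟨ +-identityʳ (t p) ⟩
  t p                        ∎
  where open ≡-Reasoning

sum-select : ∀ {m} (p : Fin m) (c : ℕ) → toℕ p ≡ c → (G : Fin m → Bool) →
             sum (λ s → ind ((c ≡ᵇ toℕ s) ∧ G s)) ≡ ind (G p)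
sum-select p c p≡c G = trans (sum-point _ p vanish)
                             (cong (λ z → ind (z ∧ G p)) (≡ᵇ-true (sym p≡c)))
  where
  vanish : ∀ s → s ≢ p → ind ((c ≡ᵇ toℕ s) ∧ G s) ≡ 0
  vanish s s≢p = cong (λ z → ind (z ∧ G s))
                      (≡ᵇ-false (λ c≡s → s≢p (toℕ-injective (trans (sym c≡s) (sym p≡c)))))

sum-↑ : ∀ m {p} (f : Fin (m + p) → ℕ) →
        sum f ≡ sum (λ i → f (i ↑ˡ p)) + sum (λ j → f (m ↑ʳ j))
sum-↑ zero    f = refl
sum-↑ (suc m) f = trans (cong (f zero +_) (sum-↑ m (f ∘ suc))) (sym (+-assoc (f zero) _ _))

sum-combine : ∀ m {p} (f : Fin (m * p) → ℕ) →
              sum f ≡ sum {m} (λ i → sum {p} (λ j → f (combine i j)))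
sum-combine zero    f = refl
sum-combine (suc m) {p} f =
  trans (sum-↑ p f) (cong (sum (λ j → f (combine {suc m} zero j)) +_) (sum-combine m (f ∘ (p ↑ʳ_))))

%-shift-cancel : ∀ {M F E} .{{_ : NonZero M}} → F + E ≡ M →
                 ∀ x → ((x + F) % M + E) % M ≡ x % M
%-shift-cancel {M} {F} {E} F+E≡M x = begin
  ((x + F) % M + E) % M          ≡⟨ %-distribˡ-+ ((x + F) % M) E M ⟩
  ((x + F) % M % M + E % M) % M  ≡⟨ cong (λ z → (z + E % M) % M) (m%n%n≡m%n (x + F) M) ⟩
  ((x + F) % M + E % M) % M      ≡⟨ sym (%-distribˡ-+ (x + F) E M) ⟩
  (x + F + E) % M                ≡⟨ cong (_% M) (trans (+-assoc x F E) (cong (x +_) F+E≡M)) ⟩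
  (x + M) % M                    ≡⟨ [m+n]%n≡m%n x M ⟩
  x % M                          ∎
  where open ≡-Reasoning

%-shift-injective : ∀ {M E x y} .{{_ : NonZero M}} → E ≤ M → x < M → y < M →
                    (x + E) % M ≡ (y + E) % M → x ≡ y
%-shift-injective {M} {E} {x} {y} E≤M x<M y<M same = begin
  x                                ≡⟨ sym (m<n⇒m%n≡m x<M) ⟩
  x % M                            ≡⟨ sym (%-shift-cancel (m+[n∸m]≡n E≤M) x) ⟩
  ((x + E) % M + (M ∸ E)) % M      ≡⟨ cong (λ z → (z + (M ∸ E)) % M) same ⟩
  ((y + E) % M + (M ∸ E)) % M      ≡⟨ %-shift-cancel (m+[n∸m]≡n E≤M) y ⟩
  y % M                            ≡⟨ m<n⇒m%n≡m y<M ⟩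
  y                                ∎
  where open ≡-Reasoning

%-shift-solution : ∀ {M E T} .{{_ : NonZero M}} → E ≤ M → T < M →
                   ((T + (M ∸ E)) % M + E) % M ≡ T
%-shift-solution E≤M T<M = trans (%-shift-cancel (m∸n+n≡m E≤M) _) (m<n⇒m%n≡m T<M)

%-shift-moves : ∀ {M x E} .{{_ : NonZero M}} → 0 < x → x < M → E < M → (x + E) % M ≢ E
%-shift-moves {M} {x} {E} x>0 x<M E<M fixed =
  <⇒≢ x>0 (sym (%-shift-injective (<⇒≤ E<M) x<M (≤-<-trans z≤n E<M)
                 (trans fixed (sym (m<n⇒m%n≡m E<M)))))

arc-and-non-arc : ∀ {n k} (A : Digraph n) → (∀ u → A u u ≡ false) → (∀ u → count (A u) ≡ k) →
  0 < k → suc k < n → Σ (Fin n) λ u → (∃ λ v → u ≢ v × A u v ≡ true) × (∃ λ v → u ≢ v × A u v ≡ false)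
arc-and-non-arc {suc m} A loopless outDeg k>0 (s≤s k<m) = zero , arc , non-arc
  where
  true≢false : true ≢ false
  true≢false ()
  arc : ∃ λ v → zero ≢ v × A zero v ≡ true
  arc with count-pos (A zero) (subst (0 <_) (sym (outDeg zero)) k>0)
  ... | v , zero→v = v , zero≢v , zero→v
    where
    zero≢v : zero ≢ v
    zero≢v refl = true≢false (trans (sym zero→v) (loopless zero))
  non-arc : ∃ λ v → zero ≢ v × A zero v ≡ false
  non-arc with count-avoid (A zero) zero (subst (_< m) (sym (outDeg zero)) k<m)
  ... | v , v≢zero , zero↛v = v , v≢zero ∘ sym , zero↛v

module PowerOneJoin {n a : ℕ} (A : Digraph n) (cell : Fin n → Fin a) where

  -- V(Γ¹_π) = V(Γ) × Fin layers; layer 0 is the bottom, layer i+1 sits above C_{i+1}.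
  layers : ℕ
  layers = suc (1 * a)

  Γ¹ : Digraph (n * layers)
  Γ¹ = join A cell 1

  infix 5 _at_
  _at_ : Fin n → Fin layers → Fin (n * layers)
  u at r = combine u r

  c : Fin n → ℕ
  c v = toℕ (cell v)

  lift : Fin a → Fin layers
  lift i = suc (cast (sym (*-identityˡ a)) i)

  toℕ-lift : ∀ i → toℕ (lift i) ≡ suc (toℕ i)
  toℕ-lift i = cong suc (toℕ-cast (sym (*-identityˡ a)) i)

  1+i<layers : ∀ i → suc (toℕ i) < layers
  1+i<layers i = subst (_< layers) (toℕ-lift i) (toℕ<n (lift i))

  jump : ℕ → Fin n → ℕ → Bool
  jump h v h' = ((h + suc (c v)) % layers) ≡ᵇ h'

  arc : Fin n → ℕ → Fin n → ℕ → Bool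
  arc u h v h' = ((h ≡ᵇ h') ∧ A u v) ∨ jump h v h'

  join-combine : ∀ u r v r' → Γ¹ (u at r) (v at r') ≡ arc u (toℕ r) v (toℕ r')
  join-combine u r v r' =
    trans (cong₂ (λ x y → definition (proj₁ x) (proj₂ x) (proj₁ y) (proj₂ y))
                 (remQuot-combine {k = layers} u r) (remQuot-combine {k = layers} v r'))
          (cong (((toℕ r ≡ᵇ toℕ r') ∧ A u v) ∨_)
                (trans (∨-identityʳ _) (cong (λ z → (z % layers) ≡ᵇ toℕ r') height)))
    where
    definition : Fin n → Fin layers → Fin n → Fin layers → Bool
    definition u r v r' = ((toℕ r ≡ᵇ toℕ r') ∧ A u v) ∨
      any (λ m0 → ((toℕ r + c v * 1 + suc m0) % layers) ≡ᵇ toℕ r') (upTo 1)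
    height : toℕ r + c v * 1 + 1 ≡ toℕ r + suc (c v)
    height = trans (cong (λ z → toℕ r + z + 1) (*-identityʳ (c v)))
                   (trans (+-assoc (toℕ r) (c v) 1) (cong (toℕ r +_) (+-comm (c v) 1)))

  jump-from-bottom : ∀ v h' → jump 0 v h' ≡ (suc (c v) ≡ᵇ h')
  jump-from-bottom v h' = cong (_≡ᵇ h') (m<n⇒m%n≡m (1+i<layers (cell v)))

  bottom-flat : ∀ u v → arc u 0 v 0 ≡ A u v
  bottom-flat u v = trans (cong (A u v ∨_) (jump-from-bottom v 0)) (∨-identityʳ (A u v))

  bottom-up : ∀ u v h → arc u 0 v (suc h) ≡ (c v ≡ᵇ h)
  bottom-up u v h = jump-from-bottom v (suc h)

  bottom-arc : ∀ u v → Γ¹ (u at zero) (v at zero) ≡ A u v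
  bottom-arc u v = trans (join-combine u zero v zero) (bottom-flat u v)

  lifted-arc : ∀ u v i → Γ¹ (u at zero) (v at lift i) ≡ (c v ≡ᵇ toℕ i)
  lifted-arc u v i = trans (join-combine u zero v (lift i))
                           (trans (cong (arc u 0 v) (toℕ-lift i)) (bottom-up u v (toℕ i)))

  bottom≢bottom : ∀ {u v} → u ≢ v → (u at zero) ≢ (v at zero)
  bottom≢bottom u≢v same = u≢v (combine-injectiveˡ _ zero _ zero same)

  bottom≢lifted : ∀ u v i → (u at zero) ≢ (v at lift i)
  bottom≢lifted u v i same = zero≢suc (combine-injectiveʳ u zero v (lift i) same)

  -- Above each w exactly one out-neighbour of (u,0): the layer sum of any H.
  layer-sum : ∀ u (H : Fin (n * layers) → Bool) w →
    sum {layers} (λ s → ind (Γ¹ (u at zero) (w at s) ∧ H (w at s)))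
      ≡ ind (A u w ∧ H (w at zero)) + ind (H (w at lift (cell w)))
  layer-sum u H w =
    cong₂ _+_ (cong (λ z → ind (z ∧ H (w at zero))) (bottom-arc u w))
      (trans (sum-cong-≗ λ s → cong (λ z → ind (z ∧ H (w at suc s)))
                                    (trans (join-combine u zero w (suc s)) (bottom-up u w (toℕ s))))
             (sum-select (cast (sym (*-identityˡ a)) (cell w)) (c w)
                         (toℕ-cast (sym (*-identityˡ a)) (cell w)) (λ s → H (w at suc s))))

  out-of-bottom : ∀ u (H : Fin (n * layers) → Bool) →
    count (λ y → Γ¹ (u at zero) y ∧ H y)
      ≡ count (λ w → A u w ∧ H (w at zero)) + count (λ w → H (w at lift (cell w)))
  out-of-bottom u H = begin
    count (λ y → Γ¹ (u at zero) y ∧ H y)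
      ≡⟨ count-as-sum (λ y → Γ¹ (u at zero) y ∧ H y) ⟩
    sum (λ y → ind (Γ¹ (u at zero) y ∧ H y))
      ≡⟨ sum-combine n (λ y → ind (Γ¹ (u at zero) y ∧ H y)) ⟩
    sum (λ w → sum (λ s → ind (Γ¹ (u at zero) (w at s) ∧ H (w at s))))
      ≡⟨ sum-cong-≗ (layer-sum u H) ⟩
    sum (λ w → ind (A u w ∧ H (w at zero)) + ind (H (w at lift (cell w))))
      ≡⟨ ∑-distrib-+ (λ w → ind (A u w ∧ H (w at zero))) (λ w → ind (H (w at lift (cell w)))) ⟩
    sum (λ w → ind (A u w ∧ H (w at zero))) + sum (λ w → ind (H (w at lift (cell w))))
      ≡⟨ sym (cong₂ _+_ (count-as-sum (λ w → A u w ∧ H (w at zero)))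
                           (count-as-sum (λ w → H (w at lift (cell w))))) ⟩
    count (λ w → A u w ∧ H (w at zero)) + count (λ w → H (w at lift (cell w))) ∎
    where open ≡-Reasoning

  out-degree-bottom : ∀ u → count (Γ¹ (u at zero)) ≡ count (A u) + n
  out-degree-bottom u = begin
    count (Γ¹ (u at zero))
      ≡⟨ count-cong {n * layers} (λ y → sym (∧-identityʳ _)) ⟩
    count (λ y → Γ¹ (u at zero) y ∧ true)
      ≡⟨ out-of-bottom u (λ _ → true) ⟩
    count (λ w → A u w ∧ true) + count {n} (λ _ → true)
      ≡⟨ cong₂ _+_ (count-cong {n} (λ w → ∧-identityʳ _)) (count-all {n}) ⟩
    count (A u) + n ∎
    where open ≡-Reasoning

  walks : ∀ u v r' → count (λ y → Γ¹ (u at zero) y ∧ Γ¹ y (v at r'))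
          ≡ count (λ w → A u w ∧ arc w 0 v (toℕ r')) + count (λ w → arc w (suc (c w)) v (toℕ r'))
  walks u v r' =
    trans (out-of-bottom u (λ y → Γ¹ y (v at r')))
          (cong₂ _+_ (count-cong λ w → cong (A u w ∧_) (join-combine w zero v r'))
                     (count-cong λ w → trans (join-combine w (lift (cell w)) v r')
                                             (cong (λ h → arc w h v (toℕ r')) (toℕ-lift (cell w)))))

  walks-to-lifted : ∀ u v i → count (λ y → Γ¹ (u at zero) y ∧ Γ¹ y (v at lift i))
    ≡ count (λ w → A u w ∧ (c v ≡ᵇ toℕ i))
      + count (λ w → ((c w ≡ᵇ toℕ i) ∧ A w v) ∨ jump (suc (c w)) v (suc (toℕ i)))
  walks-to-lifted u v i =
    trans (walks u v (lift i))
          (trans (cong (λ h → count (λ w → A u w ∧ arc w 0 v h) + count (λ w → arc w (suc (c w)) v h))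
                       (toℕ-lift i))
                 (cong (_+ _) (count-cong λ w → cong (A u w ∧_) (bottom-up w v (toℕ i)))))

  jump-moves-source : ∀ w v → (suc (c w) + suc (c v)) % layers ≢ suc (c w)
  jump-moves-source w v = %-shift-moves (s≤s z≤n) (1+i<layers (cell v)) (1+i<layers (cell w))
                        ∘ trans (cong (_% layers) (+-comm (suc (c v)) (suc (c w))))

  jump-moves-target : ∀ w v → (suc (c w) + suc (c v)) % layers ≢ suc (c v)
  jump-moves-target w v = %-shift-moves (s≤s z≤n) (1+i<layers (cell w)) (1+i<layers (cell v))

  lift-onto : ∀ h → 0 < h → h < layers → ∃ λ (i : Fin a) → suc (toℕ i) ≡ h
  lift-onto (suc h) _ (s≤s h<1a) = fromℕ< h<a , cong suc (toℕ-fromℕ< h<a)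
    where
    h<a : h < a
    h<a = subst (h <_) (*-identityˡ a) h<1a

  module Homogeneous (b : ℕ) (hom : IsHomogeneous cell b) where

    -- For heights E ≢ T, the w whose jump by E reaches T form exactly one cell.
    jumps-hitting : ∀ E T → E < layers → T < layers → E ≢ T →
                    count (λ w → ((suc (c w) + E) % layers) ≡ᵇ T) ≡ b
    jumps-hitting E T E<L T<L E≢T = trans (count-cong same-test) (hom j)
      where
      d : ℕ
      d = (T + (layers ∸ E)) % layers
      d-solves : (d + E) % layers ≡ T
      d-solves = %-shift-solution {M = layers} {E = E} {T = T} (<⇒≤ E<L) T<L
      d<L : d < layers
      d<L = m%n<n (T + (layers ∸ E)) layers
      d>0 : 0 < d
      d>0 = n≢0⇒n>0 λ d≡0 →
        E≢T (trans (sym (m<n⇒m%n≡m E<L)) (trans (cong (λ z → (z + E) % layers) (sym d≡0)) d-solves))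
      j : Fin a
      j = proj₁ (lift-onto d d>0 d<L)
      1+j≡d : suc (toℕ j) ≡ d
      1+j≡d = proj₂ (lift-onto d d>0 d<L)
      same-test : ∀ w → (((suc (c w) + E) % layers) ≡ᵇ T) ≡ (c w ≡ᵇ toℕ j)
      same-test w = ⇔→≡ {z = true} (mk⇔ to from)
        where
        to : (((suc (c w) + E) % layers) ≡ᵇ T) ≡ true → (c w ≡ᵇ toℕ j) ≡ true
        to hit = ≡ᵇ-true (suc-injective (trans
          (%-shift-injective (<⇒≤ E<L) (1+i<layers (cell w)) d<L (trans (≡ᵇ-sound hit) (sym d-solves)))
          (sym 1+j≡d)))
        from : (c w ≡ᵇ toℕ j) ≡ true → (((suc (c w) + E) % layers) ≡ᵇ T) ≡ true
        from w∈j = ≡ᵇ-true (trans (cong (λ z → (z + E) % layers)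
                                        (trans (cong suc (≡ᵇ-sound w∈j)) 1+j≡d)) d-solves)

    -- Walks into (v,0): those of Γ, plus one cell of jump-around walks.
    walks-to-bottom : ∀ u v → count (λ y → Γ¹ (u at zero) y ∧ Γ¹ y (v at zero))
                              ≡ count (λ w → A u w ∧ A w v) + b
    walks-to-bottom u v =
      trans (walks u v zero)
            (cong₂ _+_ (count-cong λ w → cong (A u w ∧_) (bottom-flat w v))
                       (jumps-hitting (suc (c v)) 0 (1+i<layers (cell v)) (s≤s z≤n) λ ()))

    walks-to-own-layer : ∀ u v → count (λ y → Γ¹ (u at zero) y ∧ Γ¹ y (v at lift (cell v)))
                                 ≡ count (A u) + arcsInto A cell (cell v) v
    walks-to-own-layer u v =
      trans (walks-to-lifted u v (cell v))
            (cong₂ _+_ (count-cong λ w → trans (cong (A u w ∧_) (≡ᵇ-true {c v} refl)) (∧-identityʳ _))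
                       (count-cong λ w → trans (cong (((c w ≡ᵇ c v) ∧ A w v) ∨_)
                                                     (≡ᵇ-false (jump-moves-target w v)))
                                               (trans (∨-identityʳ _) (∧-comm (c w ≡ᵇ c v) (A w v)))))

    walks-to-other-layer : ∀ u v i → c v ≢ toℕ i →
      count (λ y → Γ¹ (u at zero) y ∧ Γ¹ y (v at lift i)) ≡ arcsInto A cell i v + b
    walks-to-other-layer u v i v∉i =
      trans (walks-to-lifted u v i)
            (cong₂ _+_ (trans (count-cong λ w → trans (cong (A u w ∧_) (≡ᵇ-false v∉i)) (∧-zeroʳ _))
                              (count-none {n}))
                       (trans (count-∨ _ _ disjoint)
                              (cong₂ _+_ (count-cong λ w → ∧-comm (c w ≡ᵇ toℕ i) (A w v))
                                         (jumps-hitting (suc (c v)) (suc (toℕ i)) (1+i<layers (cell v))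
                                                        (1+i<layers i) (v∉i ∘ suc-injective)))))
      where
      disjoint : ∀ w → ((c w ≡ᵇ toℕ i) ∧ A w v) ∧ jump (suc (c w)) v (suc (toℕ i)) ≡ false
      disjoint w with c w ≡ᵇ toℕ i in w∈i
      ... | false = refl
      ... | true  = trans (cong (A w v ∧_) (≡ᵇ-false λ hit →
                            jump-moves-source w v (trans hit (cong suc (sym (≡ᵇ-sound w∈i))))))
                          (∧-zeroʳ (A w v))

    module ReadOff {k̃ t̃ λ̃ μ̃ : ℕ} (Γ¹-dsrg : IsDSRG (n * layers) Γ¹ k̃ t̃ λ̃ μ̃) where
      open IsDSRG Γ¹-dsrg

      k̃-at : ∀ u → k̃ ≡ n + count (A u)
      k̃-at u = trans (sym (outDeg (u at zero))) (trans (out-degree-bottom u) (+-comm (count (A u)) n))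

      t̃-at : ∀ u → t̃ ≡ b + count (λ w → A u w ∧ A w u)
      t̃-at u = trans (sym (sqDiag (u at zero))) (trans (walks-to-bottom u u) (+-comm _ b))

      λ̃-at : ∀ u v → u ≢ v → A u v ≡ true → λ̃ ≡ b + count (λ w → A u w ∧ A w v)
      λ̃-at u v u≢v u→v =
        trans (sym (sqArc (u at zero) (v at zero) (bottom≢bottom u≢v) (trans (bottom-arc u v) u→v)))
              (trans (walks-to-bottom u v) (+-comm _ b))

      μ̃-at : ∀ u v → u ≢ v → A u v ≡ false → μ̃ ≡ b + count (λ w → A u w ∧ A w v)
      μ̃-at u v u≢v u↛v =
        trans (sym (sqNonArc (u at zero) (v at zero) (bottom≢bottom u≢v) (trans (bottom-arc u v) u↛v)))
              (trans (walks-to-bottom u v) (+-comm _ b))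

      -- (u,0) → (v, c v + 1) is an arc: λ̃ counts v's in-neighbours in its own cell.
      own-cell-at : ∀ u v → arcsInto A cell (cell v) v + count (A u) ≡ λ̃
      own-cell-at u v =
        trans (+-comm (arcsInto A cell (cell v) v) (count (A u)))
              (trans (sym (walks-to-own-layer u v))
                     (sqArc (u at zero) (v at lift (cell v)) (bottom≢lifted u v (cell v))
                            (trans (lifted-arc u v (cell v)) (≡ᵇ-true {c v} refl))))

      -- (u,0) ↛ (v, i + 1) for v ∉ C_{i+1}: μ̃ counts v's in-neighbours in C_{i+1}.
      other-cell-at : ∀ u v i → c v ≢ toℕ i → arcsInto A cell i v + b ≡ μ̃
      other-cell-at u v i v∉i =
        trans (sym (walks-to-other-layer u v i v∉i))
              (sqNonArc (u at zero) (v at lift i) (bottom≢lifted u v i)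
                        (trans (lifted-arc u v i) (≡ᵇ-false v∉i)))

theorem1 : ∀ {n a} (A : Digraph n) (k t λ' μ : ℕ) →
    IsDSRG n A k t λ' μ →
    0 < k → suc k < n →
    (cell : Fin n → Fin a) (b : ℕ) → IsHomogeneous cell b →
    (k̃ t̃ λ̃ μ̃ : ℕ) → IsDSRG (n * suc (1 * a)) (join A cell 1) k̃ t̃ λ̃ μ̃ →
    (n * suc (1 * a) ≡ (a + 1) * n × k̃ ≡ n + k × t̃ ≡ b + t ×
     λ̃ ≡ b + λ' × μ̃ ≡ b + μ) ×
    (∀ (i l : Fin a) (v : Fin n) → cell v ≡ l →
       (i ≡ l → arcsInto A cell i v + k ≡ λ' + b) ×
       (i ≢ l → arcsInto A cell i v ≡ μ))
theorem1 {n} {a} A k t λ' μ Γ-dsrg k>0 1+k<n cell b hom k̃ t̃ λ̃ μ̃ Γ¹-dsrg =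
  (vertices , k̃≡ , t̃≡ , λ̃≡ , μ̃≡) , λ i l v v∈l → same-cell i l v v∈l , other-cell i l v v∈l
  where
  open PowerOneJoin A cell
  open Homogeneous b hom
  open ReadOff Γ¹-dsrg
  open IsDSRG Γ-dsrg
  witnesses : Σ (Fin n) λ u → (∃ λ v → u ≢ v × A u v ≡ true) × (∃ λ v → u ≢ v × A u v ≡ false)
  witnesses = arc-and-non-arc A loopless outDeg k>0 1+k<n
  u : Fin n
  u = proj₁ witnesses

  vertices : n * suc (1 * a) ≡ (a + 1) * n
  vertices = trans (*-comm n _) (cong (_* n) (trans (cong suc (*-identityˡ a)) (+-comm 1 a)))
  k̃≡ : k̃ ≡ n + k
  k̃≡ = trans (k̃-at u) (cong (n +_) (outDeg u))
  t̃≡ : t̃ ≡ b + t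
  t̃≡ = trans (t̃-at u) (cong (b +_) (sqDiag u))
  λ̃≡ : λ̃ ≡ b + λ'
  λ̃≡ = let (v , u≢v , u→v) = proj₁ (proj₂ witnesses) in
       trans (λ̃-at u v u≢v u→v) (cong (b +_) (sqArc u v u≢v u→v))
  μ̃≡ : μ̃ ≡ b + μ
  μ̃≡ = let (v , u≢v , u↛v) = proj₂ (proj₂ witnesses) in
       trans (μ̃-at u v u≢v u↛v) (cong (b +_) (sqNonArc u v u≢v u↛v))

  same-cell : ∀ i l v → cell v ≡ l → i ≡ l → arcsInto A cell i v + k ≡ λ' + b
  same-cell i l v v∈l i≡l =
    trans (cong₂ _+_ (cong (λ j → arcsInto A cell j v) (trans i≡l (sym v∈l))) (sym (outDeg u)))
          (trans (own-cell-at u v) (trans λ̃≡ (+-comm b λ')))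
  other-cell : ∀ i l v → cell v ≡ l → i ≢ l → arcsInto A cell i v ≡ μ
  other-cell i l v v∈l i≢l =
    +-cancelʳ-≡ b _ μ (trans (other-cell-at u v i λ v≡i → i≢l (trans (sym (toℕ-injective v≡i)) v∈l))
                             (trans μ̃≡ (+-comm b μ)))
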